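{- The translation from PNL to HOL is not sound for full PNL: there exist sets of PNL propositions $\Phi,\Psi$ and a finite list of distinct atoms $D$ such that $D\vdash\Phi$, $D\vdash\Psi$, and $\Phi\vdash\Psi$ is derivable in full PNL, but $[\![\Phi]\!]_D\vdash_{HOL}[\![\Psi]\!]_D$ is not derivable in HOL.
   Context: PNL: sorts $\alpha::=\nu\mid(\alpha_1,\dots,\alpha_n)\mid[\nu]\alpha\mid\tau$ (name sorts $\nu$, base sorts $\tau$); each $\mathbb A_\nu$ is a countably infinite set of atoms; permission sets are sets of atoms of the form $(\mathbb A^{<}\cup A)\setminus B$ for a fixed infinite, coinfinite set $\mathbb A^{<}$ and finite $A\subseteq\mathbb A\setminus\mathbb A^{<}$, $B\subseteq\mathbb A^{<}$. A signature has term-formers $\mathsf f:(\alpha)\tau$, proposition-formers $\mathsf P:\alpha$, unknowns $X$ with sort and permission set $\mathrm{pmss}(X)$. Permutations $\pi$ are finitely-supported sort-preserving bijections on atoms. Terms: atoms, tuples, $\mathsf f(r)$, $[a]r$, $\pi\cdot X$; propositions $\bot,\phi\supset\psi,\mathsf P(r),\forall X.\phi$, modulo $\alpha$-equivalence; $\pi$ acts by renaming atoms ($\pi\cdot(\pi'\cdot X)=(\pi\circ\pi')\cdot X$). Full PNL sequents $\Phi\vdash\Psi$ are derived by the rules: $\Phi,\phi\vdash\pi\cdot\phi,\Psi$ for any permutation $\pi$; $\Phi,\bot\vdash\Psi$; the usual $\supset$-left/right rules; $\forall$-left (instantiate $X$ by any $r:\mathrm{sort}(X)$ with free atoms in $\mathrm{pmss}(X)$);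 $\forall$-right with eigenvariable condition. HOL: simply-typed $\lambda$-calculus with base type $o$, constants $\bot,\supset,\forall_\beta$ and the usual sequent calculus $\vdash_{HOL}$. Translation: HOL types $\mu_\nu,\mu_\tau$, $[\![[\nu]\alpha]\!]=\mu_\nu\to[\![\alpha]\!]$, products componentwise; constants $\mathsf g_{\mathsf f}$, $\mathsf g_{\mathsf P}:[\![\alpha]\!]\to o$; atoms are HOL variables; for unknown $X$ and finite list $D$ of distinct atoms a HOL variable $X_D$; $[\![a]\!]_D=a$, $[\![\mathsf f(r)]\!]_D=\mathsf g_{\mathsf f}[\![r]\!]_D$, $[\![[a]r]\!]_D=\lambda a.[\![r]\!]_D$, $[\![\pi\cdot X]\!]_D=X_D$ applied to the atoms of $\pi\cdot(D\cap\mathrm{pmss}(X))$, $[\![\mathsf P(r)]\!]_D=\mathsf g_{\mathsf P}[\![r]\!]_D$, $[\![\bot]\!]_D=\bot$, $[\![\phi\supset\psi]\!]_D={\supset}[\![\phi]\!]_D[\![\psi]\!]_D$, $[\![\forall X.\phi]\!]_D=\forall(\lambda X_D.[\![\phi]\!]_D)$, pointwise on sets. Capture typing $D\vdash r:A$: atoms and $\bot$ always; compound terms/propositions if all immediate parts are (with the same $A$); $D\vdash[a]r:A$ if $D\vdash r:A\cup\{a\}$; $D\vdash\pi\cdot X:A$ if $(\mathrm{nontriv}(\pi)\cup A)\cap\mathrm{pmss}(X)\subseteq D$. $D\vdash\Phi$ means $D\vdash\phi:\emptyset$ for all $\phi\in\Phi$. -}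

module Defs where

open import Data.Nat using (ℕ; zero; suc; _≡ᵇ_)
open import Data.Bool using (Bool; true; false; _∧_; _∨_; not; if_then_else_)
open import Data.List using (List; []; _∷_; _++_; reverse)
open import Data.List.Relation.Unary.All using (All)
open import Data.List.Membership.Propositional using (_∈_; _∉_)
open import Data.List.Relation.Binary.Pointwise using (Pointwise)
open import Data.Product using (Σ; _×_; _,_)
open import Data.Sum using (_⊎_)
open import Relation.Binary.PropositionalEquality using (_≡_; _≢_)
open import Relation.Binary.Construct.Closure.Equivalence using (EqClosure)

filterB : {A : Set} → (A → Bool) → List A → List A
filterB p [] = []
filterB p (x ∷ xs) = if p x then x ∷ filterB p xs else filterB p xs

data _!_≔_ {A : Set} : List A → ℕ → A → Set where
  here  : ∀ {x xs} → (x ∷ xs) ! zero ≔ x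
  there : ∀ {x y xs i} → xs ! i ≔ y → (x ∷ xs) ! suc i ≔ y

data Sort : Set where
  nameS : ℕ → Sort
  tupS  : List Sort → Sort
  absS  : ℕ → Sort → Sort
  baseS : ℕ → Sort

mutual
  eqSort : Sort → Sort → Bool
  eqSort (nameS m) (nameS n) = m ≡ᵇ n
  eqSort (tupS as) (tupS bs) = eqSorts as bs
  eqSort (absS m a) (absS n b) = (m ≡ᵇ n) ∧ eqSort a b
  eqSort (baseS m) (baseS n) = m ≡ᵇ n
  eqSort _ _ = false

  eqSorts : List Sort → List Sort → Bool
  eqSorts [] [] = true
  eqSorts (a ∷ as) (b ∷ bs) = eqSort a b ∧ eqSorts as bs
  eqSorts _ _ = false

record Atom : Set where
  constructor atom
  field
    ns : ℕ
    ix : ℕ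
open Atom public

eqAtom : Atom → Atom → Bool
eqAtom a b = (ns a ≡ᵇ ns b) ∧ (ix a ≡ᵇ ix b)

elemA : Atom → List Atom → Bool
elemA a [] = false
elemA a (b ∷ bs) = eqAtom a b ∨ elemA a bs

eqAtoms : List Atom → List Atom → Bool
eqAtoms [] [] = true
eqAtoms (a ∷ as) (b ∷ bs) = eqAtom a b ∧ eqAtoms as bs
eqAtoms _ _ = false

-- The fixed set 𝔸^< is given as a Boolean predicate lt; it is assumed
-- infinite and coinfinite (in the theorem).
Infinite : (Atom → Bool) → Set
Infinite lt = (L : List Atom) → Σ Atom λ a → a ∉ L × lt a ≡ true

Coinfinite : (Atom → Bool) → Set
Coinfinite lt = (L : List Atom) → Σ Atom λ a → a ∉ L × lt a ≡ false

-- Permission sets (𝔸^< ∪ A) \ B, with finite A, B given as lists.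
record PermSet : Set where
  constructor pms
  field
    plus  : List Atom
    minus : List Atom
open PermSet public

inPmss : (Atom → Bool) → Atom → PermSet → Bool
inPmss lt a p = (lt a ∨ elemA a (plus p)) ∧ not (elemA a (minus p))

eqPermSet : PermSet → PermSet → Bool
eqPermSet p q = eqAtoms (plus p) (plus q) ∧ eqAtoms (minus p) (minus q)

record Unknown : Set where
  constructor unk
  field
    usort : Sort
    upmss : PermSet
    uidx  : ℕ
open Unknown public

eqUnk : Unknown → Unknown → Bool
eqUnk X Y = eqSort (usort X) (usort Y) ∧ eqPermSet (upmss X) (upmss Y)
            ∧ (uidx X ≡ᵇ uidx Y)

-- Permutations: finitely supported sort-preserving bijections, represented
-- as finite composites of sort-preserving swappings (a b).
record Swap : Set where
  constructor swap
  field
    sl sr : Atom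
    same  : ns sl ≡ ns sr
open Swap public

Perm : Set
Perm = List Swap

swapA : Swap → Atom → Atom
swapA s c = if eqAtom c (sl s) then sr s else (if eqAtom c (sr s) then sl s else c)

-- act (s1 ∷ … ∷ sn) = s1 ∘ … ∘ sn ; composition π ∘ π' is π ++ π'.
act : Perm → Atom → Atom
act [] c = c
act (s ∷ π) c = swapA s (act π c)

actInv : Perm → Atom → Atom
actInv π = act (reverse π)

record Signature : Set₁ where
  field
    TF    : Set
    tfArg : TF → Sort
    tfRes : TF → ℕ
    PF    : Set
    pfArg : PF → Sort

module Core (lt : Atom → Bool) (S : Signature) where
  open Signature S

  data Term : Set where
    atm  : Atom → Term
    tpl  : List Term → Term
    fap  : TF → Term → Term
    abst : Atom → Term → Term
    susp : Perm → Unknown → Term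

  data Form : Set where
    ⊥ₚ   : Form
    _⊃_  : Form → Form → Form
    pap  : PF → Term → Form
    all  : Unknown → Form → Form

  data HasSort : Term → Sort → Set where
    s-atm  : ∀ a → HasSort (atm a) (nameS (ns a))
    s-tpl  : ∀ {rs αs} → Pointwise HasSort rs αs → HasSort (tpl rs) (tupS αs)
    s-fap  : ∀ {f r} → HasSort r (tfArg f) → HasSort (fap f r) (baseS (tfRes f))
    s-abs  : ∀ {a r α} → HasSort r α → HasSort (abst a r) (absS (ns a) α)
    s-susp : ∀ π X → HasSort (susp π X) (usort X)

  data WF : Form → Set where
    wf-⊥   : WF ⊥ₚ
    wf-⊃   : ∀ {φ ψ} → WF φ → WF ψ → WF (φ ⊃ ψ)
    wf-pap : ∀ {P r} → HasSort r (pfArg P) → WF (pap P r)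
    wf-all : ∀ {X φ} → WF φ → WF (all X φ)

  mutual
    permT : Perm → Term → Term
    permT π (atm a) = atm (act π a)
    permT π (tpl rs) = tpl (permTs π rs)
    permT π (fap f r) = fap f (permT π r)
    permT π (abst a r) = abst (act π a) (permT π r)
    permT π (susp π' X) = susp (π ++ π') X

    permTs : Perm → List Term → List Term
    permTs π [] = []
    permTs π (r ∷ rs) = permT π r ∷ permTs π rs

  permF : Perm → Form → Form
  permF π ⊥ₚ = ⊥ₚ
  permF π (φ ⊃ ψ) = permF π φ ⊃ permF π ψ
  permF π (pap P r) = pap P (permT π r)
  permF π (all X φ) = all X (permF π φ)

  mutual
    faT : Atom → Term → Bool
    faT b (atm a) = eqAtom a b
    faT b (tpl rs) = faTs b rs
    faT b (fap f r) = faT b r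
    faT b (abst a r) = not (eqAtom a b) ∧ faT b r
    faT b (susp π X) = inPmss lt (actInv π b) (upmss X)

    faTs : Atom → List Term → Bool
    faTs b [] = false
    faTs b (r ∷ rs) = faT b r ∨ faTs b rs

  mutual
    unkT : Term → List Unknown
    unkT (atm a) = []
    unkT (tpl rs) = unkTs rs
    unkT (fap f r) = unkT r
    unkT (abst a r) = unkT r
    unkT (susp π X) = X ∷ []

    unkTs : List Term → List Unknown
    unkTs [] = []
    unkTs (r ∷ rs) = unkT r ++ unkTs rs

  fuF : Form → List Unknown
  fuF ⊥ₚ = []
  fuF (φ ⊃ ψ) = fuF φ ++ fuF ψ
  fuF (pap P r) = unkT r
  fuF (all X φ) = filterB (λ Y → not (eqUnk X Y)) (fuF φ)

  bndF : Form → List Unknown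
  bndF ⊥ₚ = []
  bndF (φ ⊃ ψ) = bndF φ ++ bndF ψ
  bndF (pap P r) = []
  bndF (all X φ) = X ∷ bndF φ

  allUnkF : Form → List Unknown
  allUnkF φ = fuF φ ++ bndF φ

  -- substitution of a term for an unknown: (π·X)[X:=r] = π·r.
  -- Capture of atoms by [a]- is intended (nominal substitution);
  -- capture of unknowns is excluded by side conditions where used.
  mutual
    subT : Unknown → Term → Term → Term
    subT X r (atm a) = atm a
    subT X r (tpl ss) = tpl (subTs X r ss)
    subT X r (fap f s) = fap f (subT X r s)
    subT X r (abst a s) = abst a (subT X r s)
    subT X r (susp π Y) = if eqUnk X Y then permT π r else susp π Y

    subTs : Unknown → Term → List Term → List Term
    subTs X r [] = []
    subTs X r (s ∷ ss) = subT X r s ∷ subTs X r ss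

  subF : Unknown → Term → Form → Form
  subF X r ⊥ₚ = ⊥ₚ
  subF X r (φ ⊃ ψ) = subF X r φ ⊃ subF X r ψ
  subF X r (pap P s) = pap P (subT X r s)
  subF X r (all Y φ) = if eqUnk X Y then all Y φ else all Y (subF X r φ)

  data _≈T_ : Term → Term → Set where
    ≈atm   : ∀ a → atm a ≈T atm a
    ≈tpl   : ∀ {rs ss} → Pointwise _≈T_ rs ss → tpl rs ≈T tpl ss
    ≈fap   : ∀ {f r s} → r ≈T s → fap f r ≈T fap f s
    ≈abs   : ∀ {a r s} → r ≈T s → abst a r ≈T abst a s
    ≈absα  : ∀ {a b r s} (e : ns b ≡ ns a) → faT b r ≡ false →
             permT (swap b a e ∷ []) r ≈T s → abst a r ≈T abst b s
    ≈susp  : ∀ {π π' X} →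
             (∀ a → inPmss lt a (upmss X) ≡ true → act π a ≡ act π' a) →
             susp π X ≈T susp π' X
    ≈symT   : ∀ {r s} → r ≈T s → s ≈T r
    ≈transT : ∀ {r s t} → r ≈T s → s ≈T t → r ≈T t

  data _≈F_ : Form → Form → Set where
    ≈⊥     : ⊥ₚ ≈F ⊥ₚ
    ≈⊃     : ∀ {φ φ' ψ ψ'} → φ ≈F φ' → ψ ≈F ψ' → (φ ⊃ ψ) ≈F (φ' ⊃ ψ')
    ≈pap   : ∀ {P r s} → r ≈T s → pap P r ≈F pap P s
    ≈all   : ∀ {X φ ψ} → φ ≈F ψ → all X φ ≈F all X ψ
    ≈allα  : ∀ {X Y φ ψ} → usort X ≡ usort Y → upmss X ≡ upmss Y →
             Y ∉ allUnkF φ → subF X (susp [] Y) φ ≈F ψ → all X φ ≈F all Y ψ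
    ≈symF   : ∀ {φ ψ} → φ ≈F ψ → ψ ≈F φ
    ≈transF : ∀ {φ ψ χ} → φ ≈F ψ → ψ ≈F χ → φ ≈F χ

  -- Full PNL sequents Φ ⊢ Ψ (Φ, Ψ finite sets, represented by lists;
  -- rules are stated up to α-equivalence via the α-rules).
  infix 4 _⊢_
  data _⊢_ : List Form → List Form → Set where
    ax   : ∀ {Γ Δ φ ψ} → φ ∈ Γ → ψ ∈ Δ → (π : Perm) → ψ ≈F permF π φ → Γ ⊢ Δ
    ⊥L   : ∀ {Γ Δ} → ⊥ₚ ∈ Γ → Γ ⊢ Δ
    ⊃L   : ∀ {Γ Δ φ ψ} → (φ ⊃ ψ) ∈ Γ → Γ ⊢ φ ∷ Δ → ψ ∷ Γ ⊢ Δ → Γ ⊢ Δ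
    ⊃R   : ∀ {Γ Δ φ ψ} → (φ ⊃ ψ) ∈ Δ → φ ∷ Γ ⊢ ψ ∷ Δ → Γ ⊢ Δ
    ∀L   : ∀ {Γ Δ X φ} (r : Term) → all X φ ∈ Γ →
           HasSort r (usort X) →
           (∀ a → faT a r ≡ true → inPmss lt a (upmss X) ≡ true) →
           (∀ Y → Y ∈ unkT r → Y ∉ bndF φ) →
           subF X r φ ∷ Γ ⊢ Δ → Γ ⊢ Δ
    ∀R   : ∀ {Γ Δ X φ} → all X φ ∈ Δ →
           All (λ χ → X ∉ fuF χ) Γ → All (λ χ → X ∉ fuF χ) Δ →
           Γ ⊢ φ ∷ Δ → Γ ⊢ Δ
    αL   : ∀ {Γ Δ φ φ'} → φ ∈ Γ → φ ≈F φ' → φ' ∷ Γ ⊢ Δ → Γ ⊢ Δ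
    αR   : ∀ {Γ Δ φ φ'} → φ ∈ Δ → φ ≈F φ' → Γ ⊢ φ' ∷ Δ → Γ ⊢ Δ

  data CapT (D : List Atom) : Term → List Atom → Set where
    ct-atm  : ∀ {a A} → CapT D (atm a) A
    ct-tpl  : ∀ {rs A} → All (λ r → CapT D r A) rs → CapT D (tpl rs) A
    ct-fap  : ∀ {f r A} → CapT D r A → CapT D (fap f r) A
    ct-abs  : ∀ {a r A} → CapT D r (a ∷ A) → CapT D (abst a r) A
    ct-susp : ∀ {π X A} →
              (∀ a → (act π a ≢ a ⊎ a ∈ A) → inPmss lt a (upmss X) ≡ true → a ∈ D) →
              CapT D (susp π X) A

  data CapF (D : List Atom) : Form → List Atom → Set where
    cf-⊥   : ∀ {A} → CapF D ⊥ₚ A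
    cf-⊃   : ∀ {φ ψ A} → CapF D φ A → CapF D ψ A → CapF D (φ ⊃ ψ) A
    cf-pap : ∀ {P r A} → CapT D r A → CapF D (pap P r) A
    cf-all : ∀ {X φ A} → CapF D φ A → CapF D (all X φ) A

  CapSet : List Atom → List Form → Set
  CapSet D Φ = All (λ φ → CapF D φ []) Φ

  data Ty : Set where
    o     : Ty
    μN    : ℕ → Ty
    μB    : ℕ → Ty
    _⇒_   : Ty → Ty → Ty
    prodT : List Ty → Ty

  mutual
    eqTy : Ty → Ty → Bool
    eqTy o o = true
    eqTy (μN m) (μN n) = m ≡ᵇ n
    eqTy (μB m) (μB n) = m ≡ᵇ n
    eqTy (A ⇒ B) (C ⇒ E) = eqTy A C ∧ eqTy B E
    eqTy (prodT As) (prodT Bs) = eqTys As Bs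
    eqTy _ _ = false

    eqTys : List Ty → List Ty → Bool
    eqTys [] [] = true
    eqTys (A ∷ As) (B ∷ Bs) = eqTy A B ∧ eqTys As Bs
    eqTys _ _ = false

  mutual
    ⟦_⟧ˢ : Sort → Ty
    ⟦ nameS ν ⟧ˢ = μN ν
    ⟦ tupS αs ⟧ˢ = prodT (⟦ αs ⟧ˢˢ)
    ⟦ absS ν α ⟧ˢ = μN ν ⇒ ⟦ α ⟧ˢ
    ⟦ baseS τ ⟧ˢ = μB τ

    ⟦_⟧ˢˢ : List Sort → List Ty
    ⟦ [] ⟧ˢˢ = []
    ⟦ α ∷ αs ⟧ˢˢ = ⟦ α ⟧ˢ ∷ ⟦ αs ⟧ˢˢ

  capAtoms : List Atom → Unknown → List Atom
  capAtoms D X = filterB (λ a → inPmss lt a (upmss X)) D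

  data VName : Set where
    vAtom : Atom → VName
    vUnk  : Unknown → List Atom → VName
    vAux  : ℕ → Ty → VName

  eqV : VName → VName → Bool
  eqV (vAtom a) (vAtom b) = eqAtom a b
  eqV (vUnk X D) (vUnk Y E) = eqUnk X Y ∧ eqAtoms D E
  eqV (vAux m A) (vAux n B) = (m ≡ᵇ n) ∧ eqTy A B
  eqV _ _ = false

  arrows : List Atom → Ty → Ty
  arrows [] B = B
  arrows (a ∷ as) B = μN (ns a) ⇒ arrows as B

  typeOfV : VName → Ty
  typeOfV (vAtom a) = μN (ns a)
  typeOfV (vUnk X D) = arrows (capAtoms D X) ⟦ usort X ⟧ˢ
  typeOfV (vAux n A) = A

  data Const : Set where
    cBot : Const
    cImp : Const
    cAll : Ty → Const
    cF   : TF → Const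
    cP   : PF → Const

  ctype : Const → Ty
  ctype cBot = o
  ctype cImp = o ⇒ (o ⇒ o)
  ctype (cAll β) = (β ⇒ o) ⇒ o
  ctype (cF f) = ⟦ tfArg f ⟧ˢ ⇒ μB (tfRes f)
  ctype (cP P) = ⟦ pfArg P ⟧ˢ ⇒ o

  data HTm : Set where
    var  : VName → HTm
    con  : Const → HTm
    app  : HTm → HTm → HTm
    lam  : VName → HTm → HTm
    htup : List HTm → HTm
    prj  : ℕ → HTm → HTm

  data HasTy : HTm → Ty → Set where
    t-var  : ∀ x → HasTy (var x) (typeOfV x)
    t-con  : ∀ c → HasTy (con c) (ctype c)
    t-app  : ∀ {t u A B} → HasTy t (A ⇒ B) → HasTy u A → HasTy (app t u) B
    t-lam  : ∀ {x t B} → HasTy t B → HasTy (lam x t) (typeOfV x ⇒ B)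
    t-tup  : ∀ {ts As} → Pointwise HasTy ts As → HasTy (htup ts) (prodT As)
    t-prj  : ∀ {t As i A} → HasTy t (prodT As) → As ! i ≔ A → HasTy (prj i t) A

  mutual
    fvH : HTm → List VName
    fvH (var x) = x ∷ []
    fvH (con c) = []
    fvH (app t u) = fvH t ++ fvH u
    fvH (lam x t) = filterB (λ y → not (eqV x y)) (fvH t)
    fvH (htup ts) = fvHs ts
    fvH (prj i t) = fvH t

    fvHs : List HTm → List VName
    fvHs [] = []
    fvHs (t ∷ ts) = fvH t ++ fvHs ts

  mutual
    bvH : HTm → List VName
    bvH (var x) = []
    bvH (con c) = []
    bvH (app t u) = bvH t ++ bvH u
    bvH (lam x t) = x ∷ bvH t
    bvH (htup ts) = bvHs ts
    bvH (prj i t) = bvH t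

    bvHs : List HTm → List VName
    bvHs [] = []
    bvHs (t ∷ ts) = bvH t ++ bvHs ts

  allVH : HTm → List VName
  allVH t = fvH t ++ bvH t

  -- (naive) substitution t[x:=u]; capture excluded by side conditions
  mutual
    substH : VName → HTm → HTm → HTm
    substH x u (var y) = if eqV x y then u else var y
    substH x u (con c) = con c
    substH x u (app t s) = app (substH x u t) (substH x u s)
    substH x u (lam y t) = if eqV x y then lam y t else lam y (substH x u t)
    substH x u (htup ts) = htup (substHs x u ts)
    substH x u (prj i t) = prj i (substH x u t)

    substHs : VName → HTm → List HTm → List HTm
    substHs x u [] = []
    substHs x u (t ∷ ts) = substH x u t ∷ substHs x u ts

  mutual
    data _⟶_ : HTm → HTm → Set where
      αstep : ∀ {x y t} → typeOfV y ≡ typeOfV x → y ∉ allVH t →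
              lam x t ⟶ lam y (substH x (var y) t)
      βstep : ∀ {x t u} → (∀ y → y ∈ fvH u → y ∉ bvH t) →
              app (lam x t) u ⟶ substH x u t
      ηstep : ∀ {x t} → x ∉ fvH t → lam x (app t (var x)) ⟶ t
      πstep : ∀ {ts i t} → ts ! i ≔ t → prj i (htup ts) ⟶ t
      appˡ  : ∀ {t t' u} → t ⟶ t' → app t u ⟶ app t' u
      appʳ  : ∀ {t u u'} → u ⟶ u' → app t u ⟶ app t u'
      lamᶜ  : ∀ {x t t'} → t ⟶ t' → lam x t ⟶ lam x t'
      tupᶜ  : ∀ {ts ts'} → ts ⟶ₗ ts' → htup ts ⟶ htup ts'
      prjᶜ  : ∀ {i t t'} → t ⟶ t' → prj i t ⟶ prj i t'

    data _⟶ₗ_ : List HTm → List HTm → Set where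
      hd : ∀ {t t' ts} → t ⟶ t' → (t ∷ ts) ⟶ₗ (t' ∷ ts)
      tl : ∀ {t ts ts'} → ts ⟶ₗ ts' → (t ∷ ts) ⟶ₗ (t ∷ ts')

  _≡βη_ : HTm → HTm → Set
  _≡βη_ = EqClosure _⟶_

  ⊥ₕ : HTm
  ⊥ₕ = con cBot

  _⊃ₕ_ : HTm → HTm → HTm
  φ ⊃ₕ ψ = app (app (con cImp) φ) ψ

  ∀ₕ : Ty → HTm → HTm
  ∀ₕ β t = app (con (cAll β)) t

  infix 4 _⊢H_
  data _⊢H_ : List HTm → List HTm → Set where
    axH   : ∀ {Γ Δ φ ψ} → φ ∈ Γ → ψ ∈ Δ → φ ≡βη ψ → Γ ⊢H Δ
    ⊥LH   : ∀ {Γ Δ} → ⊥ₕ ∈ Γ → Γ ⊢H Δ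
    ⊃LH   : ∀ {Γ Δ φ ψ} → (φ ⊃ₕ ψ) ∈ Γ → Γ ⊢H φ ∷ Δ → ψ ∷ Γ ⊢H Δ → Γ ⊢H Δ
    ⊃RH   : ∀ {Γ Δ φ ψ} → (φ ⊃ₕ ψ) ∈ Δ → φ ∷ Γ ⊢H ψ ∷ Δ → Γ ⊢H Δ
    ∀LH   : ∀ {Γ Δ β t} (u : HTm) → ∀ₕ β t ∈ Γ → HasTy u β →
            app t u ∷ Γ ⊢H Δ → Γ ⊢H Δ
    ∀RH   : ∀ {Γ Δ β t} (y : VName) → ∀ₕ β t ∈ Δ → typeOfV y ≡ β →
            All (λ χ → y ∉ fvH χ) Γ → All (λ χ → y ∉ fvH χ) Δ →
            Γ ⊢H app t (var y) ∷ Δ → Γ ⊢H Δ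
    convL : ∀ {Γ Δ φ φ'} → φ ∈ Γ → φ ≡βη φ' → HasTy φ' o → φ' ∷ Γ ⊢H Δ → Γ ⊢H Δ
    convR : ∀ {Γ Δ φ φ'} → φ ∈ Δ → φ ≡βη φ' → HasTy φ' o → Γ ⊢H φ' ∷ Δ → Γ ⊢H Δ

  apps : HTm → List HTm → HTm
  apps t [] = t
  apps t (u ∷ us) = apps (app t u) us

  atomVars : Perm → List Atom → List HTm
  atomVars π [] = []
  atomVars π (a ∷ as) = var (vAtom (act π a)) ∷ atomVars π as

  mutual
    trT : List Atom → Term → HTm
    trT D (atm a) = var (vAtom a)
    trT D (tpl rs) = htup (trTs D rs)
    trT D (fap f r) = app (con (cF f)) (trT D r)
    trT D (abst a r) = lam (vAtom a) (trT D r)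
    trT D (susp π X) = apps (var (vUnk X D)) (atomVars π (capAtoms D X))

    trTs : List Atom → List Term → List HTm
    trTs D [] = []
    trTs D (r ∷ rs) = trT D r ∷ trTs D rs

  trF : List Atom → Form → HTm
  trF D ⊥ₚ = ⊥ₕ
  trF D (φ ⊃ ψ) = trF D φ ⊃ₕ trF D ψ
  trF D (pap P r) = app (con (cP P)) (trT D r)
  trF D (all X φ) = ∀ₕ (typeOfV (vUnk X D)) (lam (vUnk X D) (trF D φ))

  trSet : List Atom → List Form → List HTm
  trSet D [] = []
  trSet D (φ ∷ Φ) = trF D φ ∷ trSet D Φ

-- In PNL the axiom rule closes  Φ, φ ⊢ π·φ, Ψ  for every permutation π, so P(a) ⊢ P(b) for any
-- two atoms a, b of the same sort, already with D empty.  Its translation  g_P a ⊢ g_P b  is not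
-- derivable in HOL.  To see this, erase HOL terms to untyped de Bruijn λ-terms with constants
-- (free variables become constants, tuples become Church pairs); then α-conversion becomes
-- syntactic identity and every HOL conversion step becomes a βη-reduction.  βη-reduction is
-- confluent (Hindley–Rosen: parallel β-reduction has Takahashi's diamond, η-reduction has the
-- diamond property up to reflexivity, and η-steps can be postponed after parallel β-steps), so
-- the distinct normal forms  g_P a  and  g_P b  are not convertible, and no formula headed by
-- ⊥, ⊃ or ∀ is convertible to either of them.  This rules out every rule of the HOL sequent
-- calculus as the last step of a derivation.

module Submission where

open import Defs
open import Data.Bool using (Bool; true; false; _∧_; not; if_then_else_)
open import Data.Bool.Properties using (∧-conicalˡ; ∧-conicalʳ; T-≡)
open import Data.Empty using (⊥; ⊥-elim)
open import Data.List using (List; []; _∷_; _++_; length)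
open import Data.List.Membership.Propositional using (_∈_; _∉_)
open import Data.List.Membership.Propositional.Properties using (∈-++⁺ˡ; ∈-++⁺ʳ)
open import Data.List.Relation.Unary.All using (All; []; _∷_; lookup)
open import Data.List.Relation.Unary.AllPairs using ([])
open import Data.List.Relation.Unary.Any using (here; there)
open import Data.List.Relation.Unary.Unique.Propositional using (Unique)
open import Data.Nat using (ℕ; zero; suc; _≡ᵇ_)
open import Data.Nat.Properties using (suc-injective; ≡ᵇ⇒≡; ≡⇒≡ᵇ)
open import Data.Product using (Σ; ∃; _×_; _,_)
open import Data.Sum using (_⊎_; inj₁; inj₂)
import Data.Sum as Sum
open import Data.Sum.Properties using (inj₂-injective)
open import Data.Unit using (⊤; tt)
open import Function using (_∘_; Equivalence)
open import Level using (0ℓ)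
open import Relation.Binary.Core using (Rel)
open import Relation.Binary.Construct.Closure.Equivalence using (EqClosure)
import Relation.Binary.Construct.Closure.Equivalence as EqClosure
open import Relation.Binary.Construct.Closure.Reflexive using (ReflClosure) renaming (refl to stay; [_] to step)
import Relation.Binary.Construct.Closure.Reflexive as Refl
open import Relation.Binary.Construct.Closure.ReflexiveTransitive using (Star; ε; _◅_; _◅◅_; _⋆)
import Relation.Binary.Construct.Closure.ReflexiveTransitive as Star
open import Relation.Binary.Construct.Closure.ReflexiveTransitive.Properties using (module StarReasoning)
import Relation.Binary.Construct.Closure.ReflexiveTransitive.Properties as StarProps
open import Relation.Binary.Construct.Closure.Symmetric using (fwd)
open import Relation.Binary.Construct.Union using (_∪_)
open import Relation.Binary.PropositionalEquality using (_≡_; _≢_; refl; sym; trans; cong; cong₂; subst; _≗_; module ≡-Reasoning)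
open import Relation.Binary.Rewriting using (Confluent; IsNormalForm; conf⇒nf; conf⇒unf)
open import Relation.Nullary using (¬_)

Diamond : {A : Set} → Rel A 0ℓ → Set
Diamond _∼_ = ∀ {a b c} → a ∼ b → a ∼ c → ∃ λ d → b ∼ d × c ∼ d

CommuteStar : {A : Set} → Rel A 0ℓ → Rel A 0ℓ → Set
CommuteStar R S = ∀ {a b c} → Star R a b → Star S a c → ∃ λ d → Star S b d × Star R c d

module _ {A : Set} {R S : Rel A 0ℓ} where

  commute⇒commuteStar : (∀ {a b c} → R a b → S a c → ∃ λ d → S b d × Star R c d) →
                        CommuteStar R S
  commute⇒commuteStar commute = commuteStar
    where
    stripS : ∀ {a b c} → Star R a b → S a c → ∃ λ d → S b d × Star R c d
    stripS ε s = _ , s , ε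
    stripS (r ◅ rs) s with commute r s
    ... | _ , s′ , cx with stripS rs s′
    ... | d , bd , xd = d , bd , cx ◅◅ xd

    commuteStar : CommuteStar R S
    commuteStar rs ε = _ , ε , rs
    commuteStar rs (s ◅ ss) with stripS rs s
    ... | _ , s′ , cx with commuteStar cx ss
    ... | d , xd , c′d = d , s′ ◅ xd , c′d

  confluent-transfer : (∀ {a b} → R a b → Star S a b) → (∀ {a b} → S a b → Star R a b) →
                       Confluent R → Confluent S
  confluent-transfer R⇒S* S⇒R* conf ab ac with conf ((S⇒R* ⋆) ab) ((S⇒R* ⋆) ac)
  ... | d , bd , cd = d , (R⇒S* ⋆) bd , (R⇒S* ⋆) cd

module _ {A : Set} {R : Rel A 0ℓ} where

  diamond⇒confluent : Diamond R → Confluent R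
  diamond⇒confluent diamond = confluent
    where
    strip : ∀ {a b c} → R a b → Star R a c → ∃ λ d → Star R b d × R c d
    strip r ε = _ , ε , r
    strip r (r′ ◅ rs) with diamond r r′
    ... | _ , bx , a′x with strip a′x rs
    ... | d , xd , cd = d , bx ◅ xd , cd

    confluent : Confluent R
    confluent ε ac = _ , ac , ε
    confluent (r ◅ rs) ac with strip r ac
    ... | _ , a′x , cx with confluent rs a′x
    ... | d , bd , xd = d , bd , cx ◅ xd

hindley-rosen : {A : Set} {R S : Rel A 0ℓ} → Confluent R → Confluent S →
                CommuteStar R S → Confluent (R ∪ S)
hindley-rosen {R = R} {S} confR confS commute =
  confluent-transfer flatten embed (diamond⇒confluent diamond)
  where
  diamond : Diamond (Star R ∪ Star S)
  diamond (inj₁ p) (inj₁ q) with confR p q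
  ... | d , x , y = d , inj₁ x , inj₁ y
  diamond (inj₂ p) (inj₂ q) with confS p q
  ... | d , x , y = d , inj₂ x , inj₂ y
  diamond (inj₁ p) (inj₂ q) with commute p q
  ... | d , x , y = d , inj₂ x , inj₁ y
  diamond (inj₂ p) (inj₁ q) with commute q p
  ... | d , x , y = d , inj₁ y , inj₂ x

  flatten : ∀ {a b} → (Star R ∪ Star S) a b → Star (R ∪ S) a b
  flatten (inj₁ p) = Star.map inj₁ p
  flatten (inj₂ q) = Star.map inj₂ q

  embed : ∀ {a b} → (R ∪ S) a b → Star (Star R ∪ Star S) a b
  embed (inj₁ r) = Star.return (inj₁ (Star.return r))
  embed (inj₂ s) = Star.return (inj₂ (Star.return s))

-- Untyped λ-calculus with constants and its βη-confluence

module Lambda (C : Set) where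

  infixl 7 _·_
  infix 9 #_

  data Tm : Set where
    K   : C → Tm
    #_  : ℕ → Tm
    _·_ : Tm → Tm → Tm
    ƛ   : Tm → Tm

  #-injective : ∀ {n m} → # n ≡ # m → n ≡ m
  #-injective refl = refl

  ·-injectiveˡ : ∀ {t t′ u u′} → t · u ≡ t′ · u′ → t ≡ t′
  ·-injectiveˡ refl = refl

  ·-injectiveʳ : ∀ {t t′ u u′} → t · u ≡ t′ · u′ → u ≡ u′
  ·-injectiveʳ refl = refl

  ƛ-injective : ∀ {t t′} → ƛ t ≡ ƛ t′ → t ≡ t′
  ƛ-injective refl = refl

  Ren : Set
  Ren = ℕ → ℕ

  Sub : Set
  Sub = ℕ → Tm

  lift : Ren → Ren
  lift ρ zero = zero
  lift ρ (suc n) = suc (ρ n)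

  ren : Ren → Tm → Tm
  ren ρ (K c) = K c
  ren ρ (# n) = # ρ n
  ren ρ (t · u) = ren ρ t · ren ρ u
  ren ρ (ƛ t) = ƛ (ren (lift ρ) t)

  ↑ : Tm → Tm
  ↑ = ren suc

  lifts : Sub → Sub
  lifts σ zero = # 0
  lifts σ (suc n) = ↑ (σ n)

  sub : Sub → Tm → Tm
  sub σ (K c) = K c
  sub σ (# n) = σ n
  sub σ (t · u) = sub σ t · sub σ u
  sub σ (ƛ t) = ƛ (sub (lifts σ) t)

  sub₀ : Tm → Sub
  sub₀ u zero = u
  sub₀ u (suc n) = # n

  _[_] : Tm → Tm → Tm
  t [ u ] = sub (sub₀ u) t

  lift-cong : ∀ {ρ ρ′} → ρ ≗ ρ′ → lift ρ ≗ lift ρ′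
  lift-cong eq zero = refl
  lift-cong eq (suc n) = cong suc (eq n)

  ren-cong : ∀ {ρ ρ′} → ρ ≗ ρ′ → ∀ t → ren ρ t ≡ ren ρ′ t
  ren-cong eq (K c) = refl
  ren-cong eq (# n) = cong #_ (eq n)
  ren-cong eq (t · u) = cong₂ _·_ (ren-cong eq t) (ren-cong eq u)
  ren-cong eq (ƛ t) = cong ƛ (ren-cong (lift-cong eq) t)

  lifts-cong : ∀ {σ σ′} → σ ≗ σ′ → lifts σ ≗ lifts σ′
  lifts-cong eq zero = refl
  lifts-cong eq (suc n) = cong ↑ (eq n)

  sub-cong : ∀ {σ σ′} → σ ≗ σ′ → ∀ t → sub σ t ≡ sub σ′ t
  sub-cong eq (K c) = refl
  sub-cong eq (# n) = eq n
  sub-cong eq (t · u) = cong₂ _·_ (sub-cong eq t) (sub-cong eq u)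
  sub-cong eq (ƛ t) = cong ƛ (sub-cong (lifts-cong eq) t)

  ren-ren : ∀ ρ ρ′ t → ren ρ (ren ρ′ t) ≡ ren (λ n → ρ (ρ′ n)) t
  ren-ren ρ ρ′ (K c) = refl
  ren-ren ρ ρ′ (# n) = refl
  ren-ren ρ ρ′ (t · u) = cong₂ _·_ (ren-ren ρ ρ′ t) (ren-ren ρ ρ′ u)
  ren-ren ρ ρ′ (ƛ t) = cong ƛ (trans (ren-ren (lift ρ) (lift ρ′) t)
                                     (ren-cong (λ { zero → refl ; (suc n) → refl }) t))

  sub-ren : ∀ σ ρ t → sub σ (ren ρ t) ≡ sub (λ n → σ (ρ n)) t
  sub-ren σ ρ (K c) = refl
  sub-ren σ ρ (# n) = refl
  sub-ren σ ρ (t · u) = cong₂ _·_ (sub-ren σ ρ t) (sub-ren σ ρ u)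
  sub-ren σ ρ (ƛ t) = cong ƛ (trans (sub-ren (lifts σ) (lift ρ) t)
                                     (sub-cong (λ { zero → refl ; (suc n) → refl }) t))

  ren-sub : ∀ ρ σ t → ren ρ (sub σ t) ≡ sub (λ n → ren ρ (σ n)) t
  ren-sub ρ σ (K c) = refl
  ren-sub ρ σ (# n) = refl
  ren-sub ρ σ (t · u) = cong₂ _·_ (ren-sub ρ σ t) (ren-sub ρ σ u)
  ren-sub ρ σ (ƛ t) = cong ƛ (trans (ren-sub (lift ρ) (lifts σ) t) (sub-cong lift-lifts t))
    where
    lift-lifts : (λ n → ren (lift ρ) (lifts σ n)) ≗ lifts (λ n → ren ρ (σ n))
    lift-lifts zero = refl
    lift-lifts (suc n) = trans (ren-ren (lift ρ) suc (σ n)) (sym (ren-ren suc ρ (σ n)))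

  sub-sub : ∀ σ τ t → sub σ (sub τ t) ≡ sub (λ n → sub σ (τ n)) t
  sub-sub σ τ (K c) = refl
  sub-sub σ τ (# n) = refl
  sub-sub σ τ (t · u) = cong₂ _·_ (sub-sub σ τ t) (sub-sub σ τ u)
  sub-sub σ τ (ƛ t) = cong ƛ (trans (sub-sub (lifts σ) (lifts τ) t) (sub-cong lifts-lifts t))
    where
    lifts-lifts : (λ n → sub (lifts σ) (lifts τ n)) ≗ lifts (λ n → sub σ (τ n))
    lifts-lifts zero = refl
    lifts-lifts (suc n) = trans (sub-ren (lifts σ) suc (τ n)) (sym (ren-sub suc σ (τ n)))

  sub-id : ∀ {σ} → σ ≗ #_ → ∀ t → sub σ t ≡ t
  sub-id eq (K c) = refl
  sub-id eq (# n) = eq n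
  sub-id eq (t · u) = cong₂ _·_ (sub-id eq t) (sub-id eq u)
  sub-id eq (ƛ t) = cong ƛ (sub-id (λ { zero → refl ; (suc n) → cong ↑ (eq n) }) t)

  ↑-[] : ∀ t u → ↑ t [ u ] ≡ t
  ↑-[] t u = trans (sub-ren (sub₀ u) suc t) (sub-id (λ n → refl) t)

  lift-↑ : ∀ ρ t → ren (lift ρ) (↑ t) ≡ ↑ (ren ρ t)
  lift-↑ ρ t = trans (ren-ren (lift ρ) suc t) (sym (ren-ren suc ρ t))

  lifts-↑ : ∀ σ t → sub (lifts σ) (↑ t) ≡ ↑ (sub σ t)
  lifts-↑ σ t = trans (sub-ren (lifts σ) suc t) (sym (ren-sub suc σ t))

  sub-[] : ∀ σ t u → sub σ (t [ u ]) ≡ sub (lifts σ) t [ sub σ u ]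
  sub-[] σ t u = begin
    sub σ (t [ u ])                      ≡⟨ sub-sub σ (sub₀ u) t ⟩
    sub (λ n → sub σ (sub₀ u n)) t       ≡⟨ sub-cong commute t ⟩
    sub (λ n → lifts σ n [ sub σ u ]) t  ≡⟨ sub-sub (sub₀ (sub σ u)) (lifts σ) t ⟨
    sub (lifts σ) t [ sub σ u ]          ∎
    where
    open ≡-Reasoning
    commute : (λ n → sub σ (sub₀ u n)) ≗ (λ n → lifts σ n [ sub σ u ])
    commute zero = refl
    commute (suc n) = sym (↑-[] (σ n) (sub σ u))

  ren-[] : ∀ ρ t u → ren ρ (t [ u ]) ≡ ren (lift ρ) t [ ren ρ u ]
  ren-[] ρ t u = begin
    ren ρ (t [ u ])                       ≡⟨ ren-sub ρ (sub₀ u) t ⟩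
    sub (λ n → ren ρ (sub₀ u n)) t        ≡⟨ sub-cong (λ { zero → refl ; (suc n) → refl }) t ⟩
    sub (λ n → sub₀ (ren ρ u) (lift ρ n)) t ≡⟨ sub-ren (sub₀ (ren ρ u)) (lift ρ) t ⟨
    ren (lift ρ) t [ ren ρ u ]            ∎
    where open ≡-Reasoning

  lift-↑-[#0] : ∀ t → ren (lift suc) t [ # 0 ] ≡ t
  lift-↑-[#0] t = trans (sub-ren (sub₀ (# 0)) (lift suc) t)
                        (sub-id (λ { zero → refl ; (suc n) → refl }) t)

  infix 4 _⇛_ _→β_ _↠β_ _→η_ _↠η_ _→η⁼_ _→βη_ _↠βη_ _=βη_

  data _⇛_ : Tm → Tm → Set where
    ⇛K : ∀ {c} → K c ⇛ K c
    ⇛# : ∀ {n} → # n ⇛ # n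
    ⇛ƛ : ∀ {t t′} → t ⇛ t′ → ƛ t ⇛ ƛ t′
    ⇛· : ∀ {t t′ u u′} → t ⇛ t′ → u ⇛ u′ → t · u ⇛ t′ · u′
    ⇛β : ∀ {t t′ u u′} → t ⇛ t′ → u ⇛ u′ → ƛ t · u ⇛ t′ [ u′ ]

  ⇛-refl : ∀ t → t ⇛ t
  ⇛-refl (K c) = ⇛K
  ⇛-refl (# n) = ⇛#
  ⇛-refl (t · u) = ⇛· (⇛-refl t) (⇛-refl u)
  ⇛-refl (ƛ t) = ⇛ƛ (⇛-refl t)

  ⇛-ren : ∀ ρ {t t′} → t ⇛ t′ → ren ρ t ⇛ ren ρ t′
  ⇛-ren ρ ⇛K = ⇛K
  ⇛-ren ρ ⇛# = ⇛#
  ⇛-ren ρ (⇛ƛ d) = ⇛ƛ (⇛-ren (lift ρ) d)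
  ⇛-ren ρ (⇛· d e) = ⇛· (⇛-ren ρ d) (⇛-ren ρ e)
  ⇛-ren ρ (⇛β {t′ = t′} {u′ = u′} d e) =
    subst (_ ⇛_) (sym (ren-[] ρ t′ u′)) (⇛β (⇛-ren (lift ρ) d) (⇛-ren ρ e))

  ⇛-lifts : ∀ {σ τ} → (∀ n → σ n ⇛ τ n) → ∀ n → lifts σ n ⇛ lifts τ n
  ⇛-lifts ⇛σ zero = ⇛#
  ⇛-lifts ⇛σ (suc n) = ⇛-ren suc (⇛σ n)

  ⇛-sub : ∀ {σ τ} → (∀ n → σ n ⇛ τ n) → ∀ {t t′} → t ⇛ t′ → sub σ t ⇛ sub τ t′
  ⇛-sub ⇛σ ⇛K = ⇛K
  ⇛-sub ⇛σ {# n} ⇛# = ⇛σ n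
  ⇛-sub ⇛σ (⇛ƛ d) = ⇛ƛ (⇛-sub (⇛-lifts ⇛σ) d)
  ⇛-sub ⇛σ (⇛· d e) = ⇛· (⇛-sub ⇛σ d) (⇛-sub ⇛σ e)
  ⇛-sub {τ = τ} ⇛σ (⇛β {t′ = t′} {u′ = u′} d e) =
    subst (_ ⇛_) (sym (sub-[] τ t′ u′)) (⇛β (⇛-sub (⇛-lifts ⇛σ) d) (⇛-sub ⇛σ e))

  ⇛-[] : ∀ {t t′ u u′} → t ⇛ t′ → u ⇛ u′ → t [ u ] ⇛ t′ [ u′ ]
  ⇛-[] d e = ⇛-sub (λ { zero → e ; (suc n) → ⇛# }) d

  develop : Tm → Tm
  develop (K c) = K c
  develop (# n) = # n
  develop (ƛ t) = ƛ (develop t)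
  develop (ƛ t · u) = develop t [ develop u ]
  develop (t · u) = develop t · develop u

  ⇛-develop : ∀ {t s} → t ⇛ s → s ⇛ develop t
  ⇛-develop ⇛K = ⇛K
  ⇛-develop ⇛# = ⇛#
  ⇛-develop (⇛ƛ d) = ⇛ƛ (⇛-develop d)
  ⇛-develop (⇛· {t = K c} d e) = ⇛· (⇛-develop d) (⇛-develop e)
  ⇛-develop (⇛· {t = # n} d e) = ⇛· (⇛-develop d) (⇛-develop e)
  ⇛-develop (⇛· {t = t₁ · t₂} d e) = ⇛· (⇛-develop d) (⇛-develop e)
  ⇛-develop (⇛· {t = ƛ t} (⇛ƛ d) e) = ⇛β (⇛-develop d) (⇛-develop e)
  ⇛-develop (⇛β d e) = ⇛-[] (⇛-develop d) (⇛-develop e)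

  ⇛-diamond : Diamond _⇛_
  ⇛-diamond {a} d e = develop a , ⇛-develop d , ⇛-develop e

  data _→β_ : Tm → Tm → Set where
    β   : ∀ {t u} → ƛ t · u →β t [ u ]
    βƛ  : ∀ {t t′} → t →β t′ → ƛ t →β ƛ t′
    β·ˡ : ∀ {t t′ u} → t →β t′ → t · u →β t′ · u
    β·ʳ : ∀ {t u u′} → u →β u′ → t · u →β t · u′

  _↠β_ : Tm → Tm → Set
  _↠β_ = Star _→β_

  ↠β-· : ∀ {t t′ u u′} → t ↠β t′ → u ↠β u′ → t · u ↠β t′ · u′
  ↠β-· {t′ = t′} {u = u} d e = Star.gmap (_· u) β·ˡ d ◅◅ Star.gmap (t′ ·_) β·ʳ e

  →β⇒⇛ : ∀ {t t′} → t →β t′ → t ⇛ t′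
  →β⇒⇛ β = ⇛β (⇛-refl _) (⇛-refl _)
  →β⇒⇛ (βƛ d) = ⇛ƛ (→β⇒⇛ d)
  →β⇒⇛ (β·ˡ d) = ⇛· (→β⇒⇛ d) (⇛-refl _)
  →β⇒⇛ (β·ʳ d) = ⇛· (⇛-refl _) (→β⇒⇛ d)

  ⇛⇒↠β : ∀ {t t′} → t ⇛ t′ → t ↠β t′
  ⇛⇒↠β ⇛K = ε
  ⇛⇒↠β ⇛# = ε
  ⇛⇒↠β (⇛ƛ d) = Star.gmap ƛ βƛ (⇛⇒↠β d)
  ⇛⇒↠β (⇛· d e) = ↠β-· (⇛⇒↠β d) (⇛⇒↠β e)
  ⇛⇒↠β (⇛β d e) = ↠β-· (Star.gmap ƛ βƛ (⇛⇒↠β d)) (⇛⇒↠β e) ◅◅ β ◅ ε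

  β-confluent : Confluent _→β_
  β-confluent = confluent-transfer ⇛⇒↠β (Star.return ∘ →β⇒⇛) (diamond⇒confluent ⇛-diamond)

  -- η carries an equation instead of the pattern  ƛ (↑ t · # 0)  so that η-steps out of renamed
  -- terms  ren ρ t  can be matched.
  data _→η_ : Tm → Tm → Set where
    η   : ∀ {s t} → s ≡ ↑ t → ƛ (s · # 0) →η t
    ηƛ  : ∀ {t t′} → t →η t′ → ƛ t →η ƛ t′
    η·ˡ : ∀ {t t′ u} → t →η t′ → t · u →η t′ · u
    η·ʳ : ∀ {t u u′} → u →η u′ → t · u →η t · u′

  _↠η_ : Tm → Tm → Set
  _↠η_ = Star _→η_

  η-ren : ∀ ρ {t t′} → t →η t′ → ren ρ t →η ren ρ t′
  η-ren ρ (η {t = t} refl) = η (lift-↑ ρ t)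
  η-ren ρ (ηƛ d) = ηƛ (η-ren (lift ρ) d)
  η-ren ρ (η·ˡ d) = η·ˡ (η-ren ρ d)
  η-ren ρ (η·ʳ d) = η·ʳ (η-ren ρ d)

  η-sub : ∀ σ {t t′} → t →η t′ → sub σ t →η sub σ t′
  η-sub σ (η {t = t} refl) = η (lifts-↑ σ t)
  η-sub σ (ηƛ d) = ηƛ (η-sub (lifts σ) d)
  η-sub σ (η·ˡ d) = η·ˡ (η-sub σ d)
  η-sub σ (η·ʳ d) = η·ʳ (η-sub σ d)

  ↠η-sub : ∀ {σ τ} → (∀ n → σ n ↠η τ n) → ∀ t → sub σ t ↠η sub τ t
  ↠η-sub ↠σ (K c) = ε
  ↠η-sub ↠σ (# n) = ↠σ n
  ↠η-sub {σ} {τ} ↠σ (t · u) =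
    Star.gmap (_· sub σ u) η·ˡ (↠η-sub ↠σ t) ◅◅ Star.gmap (sub τ t ·_) η·ʳ (↠η-sub ↠σ u)
  ↠η-sub ↠σ (ƛ t) = Star.gmap ƛ ηƛ (↠η-sub ↠lifts t)
    where
    ↠lifts : ∀ n → _ ↠η _
    ↠lifts zero = ε
    ↠lifts (suc n) = Star.gmap ↑ (η-ren suc) (↠σ n)

  ↠η-[] : ∀ t {u u′} → u ↠η u′ → t [ u ] ↠η t [ u′ ]
  ↠η-[] t d = ↠η-sub (λ { zero → d ; (suc n) → ε }) t

  ↑-injective : ∀ {t t′} → ↑ t ≡ ↑ t′ → t ≡ t′
  ↑-injective {t} {t′} eq = trans (sym (↑-[] t (# 0))) (trans (cong _[ # 0 ] eq) (↑-[] t′ (# 0)))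

  Pullback : Ren → Ren → Ren → Set
  Pullback f g h = ∀ n m → f n ≡ g m → ∃ λ j → n ≡ g j × m ≡ h j

  Pullback-lift : ∀ {f g h} → Pullback f g h → Pullback (lift f) (lift g) (lift h)
  Pullback-lift pb zero zero eq = zero , refl , refl
  Pullback-lift pb (suc n) (suc m) eq with pb n m (suc-injective eq)
  ... | j , refl , refl = suc j , refl , refl

  Pullback-suc : ∀ ρ → Pullback (lift ρ) suc ρ
  Pullback-suc ρ (suc n) m refl = n , refl , refl

  strengthen : ∀ {f g h} → Pullback f g h → ∀ p q → ren f p ≡ ren g q →
               ∃ λ q₀ → p ≡ ren g q₀ × q ≡ ren h q₀
  strengthen pb (K c) (K .c) refl = K c , refl , refl
  strengthen pb (# n) (# m) eq with pb n m (#-injective eq)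
  ... | j , refl , refl = # j , refl , refl
  strengthen pb (p · p′) (q · q′) eq
    with strengthen pb p q (·-injectiveˡ eq) | strengthen pb p′ q′ (·-injectiveʳ eq)
  ... | q₀ , refl , refl | q₀′ , refl , refl = q₀ · q₀′ , refl , refl
  strengthen pb (ƛ p) (ƛ q) eq with strengthen (Pullback-lift pb) p q (ƛ-injective eq)
  ... | q₀ , refl , refl = ƛ q₀ , refl , refl

  ren-reflects-⇛ : ∀ ρ t {r} → ren ρ t ⇛ r → ∃ λ t′ → r ≡ ren ρ t′ × t ⇛ t′
  ren-reflects-⇛ ρ (K c) ⇛K = K c , refl , ⇛K
  ren-reflects-⇛ ρ (# n) ⇛# = # n , refl , ⇛#
  ren-reflects-⇛ ρ (ƛ t) (⇛ƛ d) with ren-reflects-⇛ (lift ρ) t d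
  ... | t′ , refl , d′ = ƛ t′ , refl , ⇛ƛ d′
  ren-reflects-⇛ ρ (ƛ t · u) (⇛β d e) with ren-reflects-⇛ (lift ρ) t d | ren-reflects-⇛ ρ u e
  ... | t′ , refl , d′ | u′ , refl , e′ = t′ [ u′ ] , sym (ren-[] ρ t′ u′) , ⇛β d′ e′
  ren-reflects-⇛ ρ (t · u) (⇛· d e) with ren-reflects-⇛ ρ t d | ren-reflects-⇛ ρ u e
  ... | t′ , refl , d′ | u′ , refl , e′ = t′ · u′ , refl , ⇛· d′ e′

  ren-reflects-→η : ∀ ρ t {r} → ren ρ t →η r → ∃ λ t′ → r ≡ ren ρ t′ × t →η t′
  ren-reflects-→η ρ (ƛ (p · # zero)) (η eq) with strengthen (Pullback-suc ρ) p _ eq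
  ... | q₀ , refl , refl = q₀ , refl , η refl
  ren-reflects-→η ρ (ƛ t) (ηƛ d) with ren-reflects-→η (lift ρ) t d
  ... | t′ , refl , d′ = ƛ t′ , refl , ηƛ d′
  ren-reflects-→η ρ (t · u) (η·ˡ d) with ren-reflects-→η ρ t d
  ... | t′ , refl , d′ = t′ · u , refl , η·ˡ d′
  ren-reflects-→η ρ (t · u) (η·ʳ d) with ren-reflects-→η ρ u d
  ... | u′ , refl , d′ = t · u′ , refl , η·ʳ d′

  _→η⁼_ : Tm → Tm → Set
  _→η⁼_ = ReflClosure _→η_

  →η⁼-diamond : Diamond _→η⁼_
  →η⁼-diamond stay d = _ , d , stay
  →η⁼-diamond (step d) stay = _ , stay , step d
  →η⁼-diamond (step d) (step e) = join d e
    where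
    join : ∀ {a b c} → a →η b → a →η c → ∃ λ d → b →η⁼ d × c →η⁼ d
    join (η eq₁) (η eq₂) with ↑-injective (trans (sym eq₁) eq₂)
    ... | refl = _ , stay , stay
    join (η {t = t} refl) (ηƛ (η·ˡ d)) with ren-reflects-→η suc t d
    ... | t′ , refl , d′ = t′ , step d′ , step (η refl)
    join (ηƛ (η·ˡ d)) (η {t = t} refl) with ren-reflects-→η suc t d
    ... | t′ , refl , d′ = t′ , step (η refl) , step d′
    join (ηƛ d₁) (ηƛ d₂) with join d₁ d₂
    ... | x , p , q = ƛ x , Refl.map ηƛ p , Refl.map ηƛ q
    join (η·ˡ d₁) (η·ˡ d₂) with join d₁ d₂
    ... | x , p , q = _ , Refl.map η·ˡ p , Refl.map η·ˡ q
    join (η·ˡ d₁) (η·ʳ d₂) = _ , step (η·ʳ d₂) , step (η·ˡ d₁)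
    join (η·ʳ d₁) (η·ˡ d₂) = _ , step (η·ˡ d₂) , step (η·ʳ d₁)
    join (η·ʳ d₁) (η·ʳ d₂) with join d₁ d₂
    ... | x , p , q = _ , Refl.map η·ʳ p , Refl.map η·ʳ q

  η-confluent : Confluent _→η_
  η-confluent = confluent-transfer →η⁼⇒↠η (Star.return ∘ step) (diamond⇒confluent →η⁼-diamond)
    where
    →η⁼⇒↠η : ∀ {t t′} → t →η⁼ t′ → t ↠η t′
    →η⁼⇒↠η stay = ε
    →η⁼⇒↠η (step d) = Star.return d

  η-redex-⇛ : ∀ t {c} → ↑ t · # 0 ⇛ c → ∃ λ d → t ⇛ d × ƛ c ↠η d
  η-redex-⇛ (ƛ t) (⇛β d ⇛#) with ren-reflects-⇛ (lift suc) t d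
  ... | t′ , refl , d′ = ƛ t′ , ⇛ƛ d′ , StarProps.reflexive _→η_ (cong ƛ (lift-↑-[#0] t′))
  η-redex-⇛ t (⇛· d ⇛#) with ren-reflects-⇛ suc t d
  ... | t′ , refl , d′ = t′ , d′ , Star.return (η refl)

  η-redex-applied-⇛ : ∀ t {c} → ↑ t · # 0 ⇛ c → ∀ {u u′} → u ⇛ u′ → ∃ λ d → t · u ⇛ d × c [ u′ ] ≡ d
  η-redex-applied-⇛ (ƛ t) (⇛β d ⇛#) {u′ = u′} e with ren-reflects-⇛ (lift suc) t d
  ... | t′ , refl , d′ = t′ [ u′ ] , ⇛β d′ e , cong _[ u′ ] (lift-↑-[#0] t′)
  η-redex-applied-⇛ t (⇛· d ⇛#) {u′ = u′} e with ren-reflects-⇛ suc t d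
  ... | t′ , refl , d′ = t′ · u′ , ⇛· d′ e , cong (_· u′) (↑-[] t′ u′)

  η-⇛-commute : ∀ {a b c} → a →η b → a ⇛ c → ∃ λ d → b ⇛ d × c ↠η d
  η-⇛-commute (η refl) (⇛ƛ d) = η-redex-⇛ _ d
  η-⇛-commute (ηƛ e) (⇛ƛ d) with η-⇛-commute e d
  ... | x , p , q = ƛ x , ⇛ƛ p , Star.gmap ƛ ηƛ q
  η-⇛-commute (η·ˡ e) (⇛· d₁ d₂) with η-⇛-commute e d₁
  ... | x , p , q = _ , ⇛· p d₂ , Star.gmap (_· _) η·ˡ q
  η-⇛-commute (η·ˡ (ηƛ e)) (⇛β d₁ d₂) with η-⇛-commute e d₁
  ... | x , p , q = _ , ⇛β p d₂ , Star.gmap _[ _ ] (η-sub _) q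
  η-⇛-commute (η·ˡ (η refl)) (⇛β d₁ d₂) with η-redex-applied-⇛ _ d₁ d₂
  ... | x , p , refl = x , p , ε
  η-⇛-commute (η·ʳ e) (⇛· d₁ d₂) with η-⇛-commute e d₂
  ... | x , p , q = _ , ⇛· d₁ p , Star.gmap (_ ·_) η·ʳ q
  η-⇛-commute (η·ʳ e) (⇛β {t′ = t′} d₁ d₂) with η-⇛-commute e d₂
  ... | x , p , q = _ , ⇛β d₁ p , ↠η-[] t′ q

  _→βη_ : Tm → Tm → Set
  _→βη_ = _→η_ ∪ _→β_

  _↠βη_ : Tm → Tm → Set
  _↠βη_ = Star _→βη_

  βη-confluent : Confluent _→βη_
  βη-confluent = hindley-rosen η-confluent β-confluent η-β-commute
    where
    η-β-commute : CommuteStar _→η_ _→β_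
    η-β-commute ab ac with commute⇒commuteStar η-⇛-commute ab (((Star.return ∘ →β⇒⇛) ⋆) ac)
    ... | d , bd , cd = d , (⇛⇒↠β ⋆) bd , cd

  →βη-ƛ : ∀ {t t′} → t →βη t′ → ƛ t →βη ƛ t′
  →βη-ƛ = Sum.map ηƛ βƛ

  →βη-·ˡ : ∀ {t t′ u} → t →βη t′ → t · u →βη t′ · u
  →βη-·ˡ = Sum.map η·ˡ β·ˡ

  →βη-·ʳ : ∀ {t u u′} → u →βη u′ → t · u →βη t · u′
  →βη-·ʳ = Sum.map η·ʳ β·ʳ

  _=βη_ : Tm → Tm → Set
  _=βη_ = EqClosure _→βη_

  data HeadedBy (c : C) : Tm → Set where
    head : HeadedBy c (K c)
    app  : ∀ {t u} → HeadedBy c t → HeadedBy c (t · u)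

  HeadedBy-→βη : ∀ {c t t′} → HeadedBy c t → t →βη t′ → HeadedBy c t′
  HeadedBy-→βη (app h) (inj₁ (η·ˡ d)) = app (HeadedBy-→βη h (inj₁ d))
  HeadedBy-→βη (app h) (inj₁ (η·ʳ d)) = app h
  HeadedBy-→βη (app h) (inj₂ (β·ˡ d)) = app (HeadedBy-→βη h (inj₂ d))
  HeadedBy-→βη (app h) (inj₂ (β·ʳ d)) = app h

  HeadedBy-↠βη : ∀ {c t t′} → HeadedBy c t → t ↠βη t′ → HeadedBy c t′
  HeadedBy-↠βη h ε = h
  HeadedBy-↠βη h (d ◅ ds) = HeadedBy-↠βη (HeadedBy-→βη h d) ds

  K·K-normal : ∀ c d → IsNormalForm _→βη_ (K c · K d)
  K·K-normal c d (_ , inj₁ (η·ˡ ()))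
  K·K-normal c d (_ , inj₁ (η·ʳ ()))
  K·K-normal c d (_ , inj₂ (β·ˡ ()))
  K·K-normal c d (_ , inj₂ (β·ʳ ()))

  HeadedBy-=βη-K·K : ∀ {c d e t} → HeadedBy c t → t =βη K d · K e → c ≡ d
  HeadedBy-=βη-K·K {d = d} {e} h conv
    with HeadedBy-↠βη h (conf⇒nf βη-confluent (K·K-normal d e) conv)
  ... | app head = refl

  =βη-K·K-injective : ∀ {c d c′ d′} → K c · K d =βη K c′ · K d′ → d ≡ d′
  =βη-K·K-injective {c} {d} {c′} {d′} conv
    with conf⇒unf βη-confluent (K·K-normal c d) (K·K-normal c′ d′) conv
  ... | refl = refl

  pair fst snd : Tm
  pair = ƛ (ƛ (ƛ (# 0 · # 2 · # 1)))
  fst = ƛ (ƛ (# 1))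
  snd = ƛ (ƛ (# 0))

  proj : ℕ → Tm → Tm
  proj zero t = t · fst
  proj (suc i) t = proj i (t · snd)

  pair-select : ∀ t u s → pair · t · u · s ↠βη s · t · u
  pair-select t u s = begin
    pair · t · u · s                               ⟶⟨ inj₂ (β·ˡ (β·ˡ β)) ⟩
    ƛ (ƛ (# 0 · ↑ (↑ t) · # 1)) · u · s            ⟶⟨ inj₂ (β·ˡ β) ⟩
    ƛ (# 0 · sub (lifts (sub₀ u)) (↑ (↑ t)) · ↑ u) · s
      ≡⟨ cong (λ x → ƛ (# 0 · x · ↑ u) · s) (trans (lifts-↑ (sub₀ u) (↑ t)) (cong ↑ (↑-[] t u))) ⟩
    ƛ (# 0 · ↑ t · ↑ u) · s                        ⟶⟨ inj₂ β ⟩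
    s · ↑ t [ s ] · ↑ u [ s ]                      ≡⟨ cong₂ (λ x y → s · x · y) (↑-[] t s) (↑-[] u s) ⟩
    s · t · u                                      ∎
    where open StarReasoning _→βη_

  fst-select : ∀ t u → fst · t · u ↠βη t
  fst-select t u = begin
    fst · t · u      ⟶⟨ inj₂ (β·ˡ β) ⟩
    ƛ (↑ t) · u      ⟶⟨ inj₂ β ⟩
    ↑ t [ u ]        ≡⟨ ↑-[] t u ⟩
    t                ∎
    where open StarReasoning _→βη_

  snd-select : ∀ t u → snd · t · u ↠βη u
  snd-select t u = inj₂ (β·ˡ β) ◅ inj₂ β ◅ ε

  proj-cong : ∀ i {t t′} → t →βη t′ → proj i t →βη proj i t′
  proj-cong zero d = →βη-·ˡ d
  proj-cong (suc i) d = proj-cong i (→βη-·ˡ d)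

  proj-ren : ∀ ρ i t → ren ρ (proj i t) ≡ proj i (ren ρ t)
  proj-ren ρ zero t = refl
  proj-ren ρ (suc i) t = proj-ren ρ i (t · snd)

  proj-sub : ∀ σ i t → sub σ (proj i t) ≡ proj i (sub σ t)
  proj-sub σ zero t = refl
  proj-sub σ (suc i) t = proj-sub σ i (t · snd)

≡ᵇ-refl : ∀ n → (n ≡ᵇ n) ≡ true
≡ᵇ-refl n = Equivalence.to T-≡ (≡⇒≡ᵇ n n refl)

≡ᵇ-sound : ∀ m n → (m ≡ᵇ n) ≡ true → m ≡ n
≡ᵇ-sound m n eq = ≡ᵇ⇒≡ m n (Equivalence.from T-≡ eq)

∧-true : ∀ {x y} → x ≡ true → y ≡ true → x ∧ y ≡ true
∧-true refl refl = refl

eqAtom-refl : ∀ a → eqAtom a a ≡ true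
eqAtom-refl (atom ν i) = ∧-true (≡ᵇ-refl ν) (≡ᵇ-refl i)

eqAtom-sound : ∀ a b → eqAtom a b ≡ true → a ≡ b
eqAtom-sound (atom ν i) (atom μ j) eq =
  cong₂ atom (≡ᵇ-sound ν μ (∧-conicalˡ _ _ eq)) (≡ᵇ-sound i j (∧-conicalʳ _ _ eq))

mutual
  eqSort-sound : ∀ α β → eqSort α β ≡ true → α ≡ β
  eqSort-sound (nameS m) (nameS n) eq = cong nameS (≡ᵇ-sound m n eq)
  eqSort-sound (tupS αs) (tupS βs) eq = cong tupS (eqSorts-sound αs βs eq)
  eqSort-sound (absS m α) (absS n β) eq =
    cong₂ absS (≡ᵇ-sound m n (∧-conicalˡ _ _ eq)) (eqSort-sound α β (∧-conicalʳ _ _ eq))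
  eqSort-sound (baseS m) (baseS n) eq = cong baseS (≡ᵇ-sound m n eq)

  eqSorts-sound : ∀ αs βs → eqSorts αs βs ≡ true → αs ≡ βs
  eqSorts-sound [] [] eq = refl
  eqSorts-sound (α ∷ αs) (β ∷ βs) eq =
    cong₂ _∷_ (eqSort-sound α β (∧-conicalˡ _ _ eq)) (eqSorts-sound αs βs (∧-conicalʳ _ _ eq))

eqAtoms-refl : ∀ as → eqAtoms as as ≡ true
eqAtoms-refl [] = refl
eqAtoms-refl (a ∷ as) = ∧-true (eqAtom-refl a) (eqAtoms-refl as)

eqAtoms-sound : ∀ as bs → eqAtoms as bs ≡ true → as ≡ bs
eqAtoms-sound [] [] eq = refl
eqAtoms-sound (a ∷ as) (b ∷ bs) eq =
  cong₂ _∷_ (eqAtom-sound a b (∧-conicalˡ _ _ eq)) (eqAtoms-sound as bs (∧-conicalʳ _ _ eq))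

mutual
  eqSort-refl : ∀ α → eqSort α α ≡ true
  eqSort-refl (nameS n) = ≡ᵇ-refl n
  eqSort-refl (tupS αs) = eqSorts-refl αs
  eqSort-refl (absS n α) = ∧-true (≡ᵇ-refl n) (eqSort-refl α)
  eqSort-refl (baseS n) = ≡ᵇ-refl n

  eqSorts-refl : ∀ αs → eqSorts αs αs ≡ true
  eqSorts-refl [] = refl
  eqSorts-refl (α ∷ αs) = ∧-true (eqSort-refl α) (eqSorts-refl αs)

eqPermSet-refl : ∀ p → eqPermSet p p ≡ true
eqPermSet-refl (pms A B) = ∧-true (eqAtoms-refl A) (eqAtoms-refl B)

eqPermSet-sound : ∀ p q → eqPermSet p q ≡ true → p ≡ q
eqPermSet-sound (pms A B) (pms A′ B′) eq =
  cong₂ pms (eqAtoms-sound A A′ (∧-conicalˡ _ _ eq)) (eqAtoms-sound B B′ (∧-conicalʳ _ _ eq))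

eqUnk-refl : ∀ X → eqUnk X X ≡ true
eqUnk-refl (unk α p i) = ∧-true (eqSort-refl α) (∧-true (eqPermSet-refl p) (≡ᵇ-refl i))

eqUnk-sound : ∀ X Y → eqUnk X Y ≡ true → X ≡ Y
eqUnk-sound (unk α p i) (unk β q j) eq
  with eqSort-sound α β (∧-conicalˡ (eqSort α β) _ eq) | ∧-conicalʳ (eqSort α β) _ eq
... | refl | rest
  with eqPermSet-sound p q (∧-conicalˡ (eqPermSet p q) _ rest)
     | ≡ᵇ-sound i j (∧-conicalʳ (eqPermSet p q) _ rest)
... | refl | refl = refl

filterB-∈ : ∀ {A : Set} (p : A → Bool) {x} xs → x ∈ xs → p x ≡ true → x ∈ filterB p xs
filterB-∈ p (y ∷ xs) (here refl) px rewrite px = here refl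
filterB-∈ p (y ∷ xs) (there x∈xs) px with p y
... | true = there (filterB-∈ p xs x∈xs px)
... | false = filterB-∈ p xs x∈xs px

∉-++ˡ : ∀ {A : Set} {x : A} xs {ys} → x ∉ xs ++ ys → x ∉ xs
∉-++ˡ xs x∉ x∈ = x∉ (∈-++⁺ˡ x∈)

∉-++ʳ : ∀ {A : Set} {x : A} xs {ys} → x ∉ xs ++ ys → x ∉ ys
∉-++ʳ xs x∉ x∈ = x∉ (∈-++⁺ʳ xs x∈)

-- Erasure of HOL terms

module HOLErasure (lt : Atom → Bool) (S : Signature) where
  open Core lt S
  open Lambda (VName ⊎ Const)

  mutual
    eqTy-refl : ∀ A → eqTy A A ≡ true
    eqTy-refl o = refl
    eqTy-refl (μN n) = ≡ᵇ-refl n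
    eqTy-refl (μB n) = ≡ᵇ-refl n
    eqTy-refl (A ⇒ B) = ∧-true (eqTy-refl A) (eqTy-refl B)
    eqTy-refl (prodT As) = eqTys-refl As

    eqTys-refl : ∀ As → eqTys As As ≡ true
    eqTys-refl [] = refl
    eqTys-refl (A ∷ As) = ∧-true (eqTy-refl A) (eqTys-refl As)

  mutual
    eqTy-sound : ∀ A B → eqTy A B ≡ true → A ≡ B
    eqTy-sound o o eq = refl
    eqTy-sound (μN m) (μN n) eq = cong μN (≡ᵇ-sound m n eq)
    eqTy-sound (μB m) (μB n) eq = cong μB (≡ᵇ-sound m n eq)
    eqTy-sound (A ⇒ B) (A′ ⇒ B′) eq =
      cong₂ _⇒_ (eqTy-sound A A′ (∧-conicalˡ _ _ eq)) (eqTy-sound B B′ (∧-conicalʳ _ _ eq))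
    eqTy-sound (prodT As) (prodT Bs) eq = cong prodT (eqTys-sound As Bs eq)

    eqTys-sound : ∀ As Bs → eqTys As Bs ≡ true → As ≡ Bs
    eqTys-sound [] [] eq = refl
    eqTys-sound (A ∷ As) (B ∷ Bs) eq =
      cong₂ _∷_ (eqTy-sound A B (∧-conicalˡ _ _ eq)) (eqTys-sound As Bs (∧-conicalʳ _ _ eq))

  eqV-refl : ∀ x → eqV x x ≡ true
  eqV-refl (vAtom a) = eqAtom-refl a
  eqV-refl (vUnk X D) = ∧-true (eqUnk-refl X) (eqAtoms-refl D)
  eqV-refl (vAux n A) = ∧-true (≡ᵇ-refl n) (eqTy-refl A)

  eqV-sound : ∀ x y → eqV x y ≡ true → x ≡ y
  eqV-sound (vAtom a) (vAtom b) eq = cong vAtom (eqAtom-sound a b eq)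
  eqV-sound (vUnk X D) (vUnk Y E) eq =
    cong₂ vUnk (eqUnk-sound X Y (∧-conicalˡ _ _ eq)) (eqAtoms-sound D E (∧-conicalʳ _ _ eq))
  eqV-sound (vAux m A) (vAux n B) eq =
    cong₂ vAux (≡ᵇ-sound m n (∧-conicalˡ _ _ eq)) (eqTy-sound A B (∧-conicalʳ _ _ eq))

  eqV-false⇒≢ : ∀ {x y} → eqV x y ≡ false → x ≢ y
  eqV-false⇒≢ {x} eq refl with trans (sym eq) (eqV-refl x)
  ... | ()

  -- Γ lists the enclosing binders, innermost first; the empty tuple may erase to any closed term.
  eraseVar : List VName → VName → Tm
  eraseVar [] y = K (inj₁ y)
  eraseVar (x ∷ Γ) y = if eqV x y then # 0 else ↑ (eraseVar Γ y)

  mutual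
    erase : List VName → HTm → Tm
    erase Γ (var y) = eraseVar Γ y
    erase Γ (con c) = K (inj₂ c)
    erase Γ (app t u) = erase Γ t · erase Γ u
    erase Γ (lam x t) = ƛ (erase (x ∷ Γ) t)
    erase Γ (htup ts) = eraseTuple Γ ts
    erase Γ (prj i t) = proj i (erase Γ t)

    eraseTuple : List VName → List HTm → Tm
    eraseTuple Γ [] = ƛ (# 0)
    eraseTuple Γ (t ∷ ts) = pair · erase Γ t · eraseTuple Γ ts

  thin : ℕ → Ren
  thin zero = suc
  thin (suc k) = lift (thin k)

  module Weaken (z : VName) (Γ : List VName) where

    eraseVar-weaken : ∀ y Δ → z ∈ Δ ⊎ z ≢ y →
                      eraseVar (Δ ++ z ∷ Γ) y ≡ ren (thin (length Δ)) (eraseVar (Δ ++ Γ) y)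
    eraseVar-weaken y [] (inj₂ z≢y) with eqV z y in eq
    ... | true = ⊥-elim (z≢y (eqV-sound z y eq))
    ... | false = refl
    eraseVar-weaken y (w ∷ Δ) unused with eqV w y in eq
    ... | true = refl
    ... | false = trans (cong ↑ (eraseVar-weaken y Δ (unused-tail unused)))
                        (sym (lift-↑ (thin (length Δ)) (eraseVar (Δ ++ Γ) y)))
      where
      unused-tail : z ∈ w ∷ Δ ⊎ z ≢ y → z ∈ Δ ⊎ z ≢ y
      unused-tail (inj₁ (here refl)) = inj₂ (eqV-false⇒≢ eq)
      unused-tail (inj₁ (there z∈Δ)) = inj₁ z∈Δ
      unused-tail (inj₂ z≢y) = inj₂ z≢y

    unused-under-lam : ∀ w t Δ → z ∈ Δ ⊎ z ∉ fvH (lam w t) → z ∈ w ∷ Δ ⊎ z ∉ fvH t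
    unused-under-lam w t Δ (inj₁ z∈Δ) = inj₁ (there z∈Δ)
    unused-under-lam w t Δ (inj₂ z∉) with eqV w z in eq
    ... | true = inj₁ (here (sym (eqV-sound w z eq)))
    ... | false = inj₂ (λ z∈ → z∉ (filterB-∈ (λ y → not (eqV w y)) (fvH t) z∈ (cong not eq)))

    mutual
      erase-weaken : ∀ t Δ → z ∈ Δ ⊎ z ∉ fvH t →
                     erase (Δ ++ z ∷ Γ) t ≡ ren (thin (length Δ)) (erase (Δ ++ Γ) t)
      erase-weaken (var y) Δ (inj₁ z∈Δ) = eraseVar-weaken y Δ (inj₁ z∈Δ)
      erase-weaken (var y) Δ (inj₂ z∉) = eraseVar-weaken y Δ (inj₂ (λ z≡y → z∉ (here z≡y)))
      erase-weaken (con c) Δ unused = refl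
      erase-weaken (app t u) Δ (inj₁ z∈Δ) =
        cong₂ _·_ (erase-weaken t Δ (inj₁ z∈Δ)) (erase-weaken u Δ (inj₁ z∈Δ))
      erase-weaken (app t u) Δ (inj₂ z∉) =
        cong₂ _·_ (erase-weaken t Δ (inj₂ (∉-++ˡ (fvH t) z∉)))
                  (erase-weaken u Δ (inj₂ (∉-++ʳ (fvH t) z∉)))
      erase-weaken (lam w t) Δ unused =
        cong ƛ (erase-weaken t (w ∷ Δ) (unused-under-lam w t Δ unused))
      erase-weaken (htup ts) Δ unused = eraseTuple-weaken ts Δ unused
      erase-weaken (prj i t) Δ unused =
        trans (cong (proj i) (erase-weaken t Δ unused))
              (sym (proj-ren (thin (length Δ)) i (erase (Δ ++ Γ) t)))

      eraseTuple-weaken : ∀ ts Δ → z ∈ Δ ⊎ z ∉ fvHs ts →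
                          eraseTuple (Δ ++ z ∷ Γ) ts
                            ≡ ren (thin (length Δ)) (eraseTuple (Δ ++ Γ) ts)
      eraseTuple-weaken [] Δ unused = refl
      eraseTuple-weaken (t ∷ ts) Δ (inj₁ z∈Δ) =
        cong₂ (λ a b → pair · a · b) (erase-weaken t Δ (inj₁ z∈Δ))
                                     (eraseTuple-weaken ts Δ (inj₁ z∈Δ))
      eraseTuple-weaken (t ∷ ts) Δ (inj₂ z∉) =
        cong₂ (λ a b → pair · a · b) (erase-weaken t Δ (inj₂ (∉-++ˡ (fvH t) z∉)))
                                     (eraseTuple-weaken ts Δ (inj₂ (∉-++ʳ (fvH t) z∉)))

  liftsⁿ : ℕ → Sub → Sub
  liftsⁿ zero σ = σ
  liftsⁿ (suc k) σ = lifts (liftsⁿ k σ)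

  sub-thin : ∀ u k t → sub (liftsⁿ k (sub₀ u)) (ren (thin k) t) ≡ t
  sub-thin u k t = trans (sub-ren _ (thin k) t) (sub-id (cancel k) t)
    where
    cancel : ∀ k → (λ n → liftsⁿ k (sub₀ u) (thin k n)) ≗ #_
    cancel zero n = refl
    cancel (suc k) zero = refl
    cancel (suc k) (suc n) = cong ↑ (cancel k n)

  Avoids : HTm → List VName → Set
  Avoids u ys = ∀ y → y ∈ fvH u → y ∉ ys

  module Substitute (x : VName) (u : HTm) (Γ : List VName) where

    σ : ℕ → Sub
    σ k = liftsⁿ k (sub₀ (erase Γ u))

    eraseVar-subst-self : ∀ Δ → x ∉ Δ → Avoids u Δ →
                          erase (Δ ++ Γ) u ≡ sub (σ (length Δ)) (eraseVar (Δ ++ x ∷ Γ) x)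
    eraseVar-subst-self [] x∉Δ avoids rewrite eqV-refl x = refl
    eraseVar-subst-self (w ∷ Δ) x∉Δ avoids with eqV w x in eq
    ... | true = ⊥-elim (x∉Δ (here (sym (eqV-sound w x eq))))
    ... | false = begin
      erase (w ∷ Δ ++ Γ) u
        ≡⟨ Weaken.erase-weaken w (Δ ++ Γ) u [] (inj₂ (λ w∈ → avoids w w∈ (here refl))) ⟩
      ↑ (erase (Δ ++ Γ) u)
        ≡⟨ cong ↑ (eraseVar-subst-self Δ (λ x∈Δ → x∉Δ (there x∈Δ))
                                         (λ y y∈ y∈Δ → avoids y y∈ (there y∈Δ))) ⟩
      ↑ (sub (σ (length Δ)) (eraseVar (Δ ++ x ∷ Γ) x))
        ≡⟨ lifts-↑ (σ (length Δ)) (eraseVar (Δ ++ x ∷ Γ) x) ⟨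
      sub (σ (suc (length Δ))) (↑ (eraseVar (Δ ++ x ∷ Γ) x)) ∎
      where open ≡-Reasoning

    eraseVar-subst-other : ∀ y Δ → eqV x y ≡ false →
                           eraseVar (Δ ++ Γ) y ≡ sub (σ (length Δ)) (eraseVar (Δ ++ x ∷ Γ) y)
    eraseVar-subst-other y [] x≠y rewrite x≠y = sym (↑-[] (eraseVar Γ y) (erase Γ u))
    eraseVar-subst-other y (w ∷ Δ) x≠y with eqV w y
    ... | true = refl
    ... | false = trans (cong ↑ (eraseVar-subst-other y Δ x≠y))
                        (sym (lifts-↑ (σ (length Δ)) (eraseVar (Δ ++ x ∷ Γ) y)))

    mutual
      erase-subst : ∀ t Δ → x ∉ Δ → Avoids u (bvH t) → Avoids u Δ →
                    erase (Δ ++ Γ) (substH x u t) ≡ sub (σ (length Δ)) (erase (Δ ++ x ∷ Γ) t)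
      erase-subst (var y) Δ x∉Δ avoids-t avoids-Δ with eqV x y in eq
      ... | true with eqV-sound x y eq
      ...   | refl = eraseVar-subst-self Δ x∉Δ avoids-Δ
      erase-subst (var y) Δ x∉Δ avoids-t avoids-Δ | false = eraseVar-subst-other y Δ eq
      erase-subst (con c) Δ x∉Δ avoids-t avoids-Δ = refl
      erase-subst (app t s) Δ x∉Δ avoids-t avoids-Δ =
        cong₂ _·_ (erase-subst t Δ x∉Δ (λ y y∈ → ∉-++ˡ (bvH t) (avoids-t y y∈)) avoids-Δ)
                  (erase-subst s Δ x∉Δ (λ y y∈ → ∉-++ʳ (bvH t) (avoids-t y y∈)) avoids-Δ)
      erase-subst (lam y t) Δ x∉Δ avoids-t avoids-Δ with eqV x y in eq
      ... | true with eqV-sound x y eq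
      ...   | refl = cong ƛ (sym (begin
        sub (σ (suc (length Δ))) (erase (x ∷ Δ ++ x ∷ Γ) t)
          ≡⟨ cong (sub (σ (suc (length Δ)))) (Weaken.erase-weaken x Γ t (x ∷ Δ) (inj₁ (here refl))) ⟩
        sub (σ (suc (length Δ))) (ren (thin (suc (length Δ))) (erase (x ∷ Δ ++ Γ) t))
          ≡⟨ sub-thin (erase Γ u) (suc (length Δ)) (erase (x ∷ Δ ++ Γ) t) ⟩
        erase (x ∷ Δ ++ Γ) t ∎))
        where open ≡-Reasoning
      erase-subst (lam y t) Δ x∉Δ avoids-t avoids-Δ | false =
        cong ƛ (erase-subst t (y ∷ Δ) x∉yΔ (λ y′ y′∈ y′∈t → avoids-t y′ y′∈ (there y′∈t)) avoids-yΔ)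
        where
        x∉yΔ : x ∉ y ∷ Δ
        x∉yΔ (here x≡y) = eqV-false⇒≢ eq x≡y
        x∉yΔ (there x∈Δ) = x∉Δ x∈Δ
        avoids-yΔ : Avoids u (y ∷ Δ)
        avoids-yΔ y′ y′∈ (here refl) = avoids-t y′ y′∈ (here refl)
        avoids-yΔ y′ y′∈ (there y′∈Δ) = avoids-Δ y′ y′∈ y′∈Δ
      erase-subst (htup ts) Δ x∉Δ avoids-t avoids-Δ = eraseTuple-subst ts Δ x∉Δ avoids-t avoids-Δ
      erase-subst (prj i t) Δ x∉Δ avoids-t avoids-Δ =
        trans (cong (proj i) (erase-subst t Δ x∉Δ avoids-t avoids-Δ))
              (sym (proj-sub (σ (length Δ)) i (erase (Δ ++ x ∷ Γ) t)))

      eraseTuple-subst : ∀ ts Δ → x ∉ Δ → Avoids u (bvHs ts) → Avoids u Δ →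
                         eraseTuple (Δ ++ Γ) (substHs x u ts)
                           ≡ sub (σ (length Δ)) (eraseTuple (Δ ++ x ∷ Γ) ts)
      eraseTuple-subst [] Δ x∉Δ avoids-ts avoids-Δ = refl
      eraseTuple-subst (t ∷ ts) Δ x∉Δ avoids-ts avoids-Δ =
        cong₂ (λ a b → pair · a · b)
              (erase-subst t Δ x∉Δ (λ y y∈ → ∉-++ˡ (bvH t) (avoids-ts y y∈)) avoids-Δ)
              (eraseTuple-subst ts Δ x∉Δ (λ y y∈ → ∉-++ʳ (bvH t) (avoids-ts y y∈)) avoids-Δ)

  eraseVar-bound : ∀ x Γ → eraseVar (x ∷ Γ) x ≡ # 0
  eraseVar-bound x Γ rewrite eqV-refl x = refl

  erase-rename : ∀ {x y} t Γ → y ∉ allVH t →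
                 erase (y ∷ Γ) (substH x (var y) t) ≡ erase (x ∷ Γ) t
  erase-rename {x} {y} t Γ y∉ = begin
    erase (y ∷ Γ) (substH x (var y) t)
      ≡⟨ Substitute.erase-subst x (var y) (y ∷ Γ) t [] (λ ()) avoids (λ _ _ ()) ⟩
    erase (x ∷ y ∷ Γ) t [ eraseVar (y ∷ Γ) y ]
      ≡⟨ cong₂ _[_] (Weaken.erase-weaken y Γ t (x ∷ []) (inj₂ (∉-++ˡ (fvH t) y∉)))
                    (eraseVar-bound y Γ) ⟩
    ren (lift suc) (erase (x ∷ Γ) t) [ # 0 ]
      ≡⟨ lift-↑-[#0] (erase (x ∷ Γ) t) ⟩
    erase (x ∷ Γ) t ∎
    where
    open ≡-Reasoning
    avoids : Avoids (var y) (bvH t)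
    avoids y′ (here refl) = ∉-++ʳ (fvH t) y∉

  erase-proj : ∀ Γ {ts i t} → ts ! i ≔ t → proj i (eraseTuple Γ ts) ↠βη erase Γ t
  erase-proj Γ here = pair-select _ _ fst ◅◅ fst-select _ _
  erase-proj Γ {i = suc i} (there p) =
    Star.gmap (proj i) (proj-cong i) (pair-select _ _ snd ◅◅ snd-select _ _) ◅◅ erase-proj Γ p

  mutual
    erase-step : ∀ Γ {t t′} → t ⟶ t′ → erase Γ t ↠βη erase Γ t′
    erase-step Γ (αstep {x} {y} {t} _ y∉) =
      StarProps.reflexive _→βη_ (cong ƛ (sym (erase-rename t Γ y∉)))
    erase-step Γ (βstep {x} {t} {u} avoids) =
      inj₂ β ◅ StarProps.reflexive _→βη_
                 (sym (Substitute.erase-subst x u Γ t [] (λ ()) avoids (λ _ _ ())))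
    erase-step Γ (ηstep {x} {t} x∉) rewrite eqV-refl x =
      Star.return (inj₁ (η (Weaken.erase-weaken x Γ t [] (inj₂ x∉))))
    erase-step Γ (πstep p) = erase-proj Γ p
    erase-step Γ (appˡ {u = u} d) = Star.gmap (_· erase Γ u) →βη-·ˡ (erase-step Γ d)
    erase-step Γ (appʳ {t = t} d) = Star.gmap (erase Γ t ·_) →βη-·ʳ (erase-step Γ d)
    erase-step Γ (lamᶜ {x} d) = Star.gmap ƛ →βη-ƛ (erase-step (x ∷ Γ) d)
    erase-step Γ (tupᶜ ds) = eraseTuple-step Γ ds
    erase-step Γ (prjᶜ {i} d) = Star.gmap (proj i) (proj-cong i) (erase-step Γ d)

    eraseTuple-step : ∀ Γ {ts ts′} → ts ⟶ₗ ts′ → eraseTuple Γ ts ↠βη eraseTuple Γ ts′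
    eraseTuple-step Γ (hd {ts = ts} d) =
      Star.gmap (λ a → pair · a · eraseTuple Γ ts) (→βη-·ˡ ∘ →βη-·ʳ) (erase-step Γ d)
    eraseTuple-step Γ (tl {t} ds) = Star.gmap (pair · erase Γ t ·_) →βη-·ʳ (eraseTuple-step Γ ds)

  erase-≡βη : ∀ Γ {t t′} → t ≡βη t′ → erase Γ t =βη erase Γ t′
  erase-≡βη Γ =
    EqClosure.gfold (EqClosure.isEquivalence _→βη_) (erase Γ) (Star.map fwd ∘ erase-step Γ)

  headed-≢βη-atomic : ∀ {c φ P x} → HeadedBy (inj₂ c) (erase [] φ) → c ≢ cP P →
                     ¬ φ ≡βη app (con (cP P)) (var x)
  headed-≢βη-atomic h c≢P conv = c≢P (inj₂-injective (HeadedBy-=βη-K·K h (erase-≡βη [] conv)))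

  ⊬H-distinct-atoms : ∀ {P a b} D → a ≢ b →
                     ¬ trSet D (pap P (atm a) ∷ []) ⊢H trSet D (pap P (atm b) ∷ [])
  ⊬H-distinct-atoms {P} {a} {b} D a≢b d = invariant d (ε ∷ []) (ε ∷ [])
    where
    Pa Pb : HTm
    Pa = app (con (cP P)) (var (vAtom a))
    Pb = app (con (cP P)) (var (vAtom b))

    invariant : ∀ {Γ Δ} → Γ ⊢H Δ → All (_≡βη Pa) Γ → All (_≡βη Pb) Δ → ⊥
    invariant (axH φ∈ ψ∈ φ≡ψ) Γ≡ Δ≡
      with =βη-K·K-injective
             (erase-≡βη [] (EqClosure.symmetric _⟶_ (lookup Γ≡ φ∈) ◅◅ φ≡ψ ◅◅ lookup Δ≡ ψ∈))
    ... | refl = a≢b refl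
    invariant (⊥LH φ∈) Γ≡ Δ≡ = headed-≢βη-atomic head (λ ()) (lookup Γ≡ φ∈)
    invariant (⊃LH φ∈ _ _) Γ≡ Δ≡ = headed-≢βη-atomic (app (app head)) (λ ()) (lookup Γ≡ φ∈)
    invariant (⊃RH φ∈ _) Γ≡ Δ≡ = headed-≢βη-atomic (app (app head)) (λ ()) (lookup Δ≡ φ∈)
    invariant (∀LH _ φ∈ _ _) Γ≡ Δ≡ = headed-≢βη-atomic (app head) (λ ()) (lookup Γ≡ φ∈)
    invariant (∀RH _ φ∈ _ _ _ _) Γ≡ Δ≡ = headed-≢βη-atomic (app head) (λ ()) (lookup Δ≡ φ∈)
    invariant (convL φ∈ conv _ d) Γ≡ Δ≡ =
      invariant d ((EqClosure.symmetric _⟶_ conv ◅◅ lookup Γ≡ φ∈) ∷ Γ≡) Δ≡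
    invariant (convR φ∈ conv _ d) Γ≡ Δ≡ =
      invariant d Γ≡ ((EqClosure.symmetric _⟶_ conv ◅◅ lookup Δ≡ φ∈) ∷ Δ≡)

swapA-left : ∀ a b e → swapA (swap a b e) a ≡ b
swapA-left a b e rewrite eqAtom-refl a = refl

module _ (lt : Atom → Bool) (S : Signature) where
  open Core lt S

  ⊢-swap : ∀ {P a b} → ns a ≡ ns b → pap P (atm a) ∷ [] ⊢ pap P (atm b) ∷ []
  ⊢-swap {P} {a} {b} e =
    ax (here refl) (here refl) (swap a b e ∷ [])
       (subst (λ c → pap P (atm b) ≈F pap P (atm c)) (sym (swapA-left a b e)) (≈pap (≈atm b)))

Sig : Signature
Sig = record { TF = ⊥ ; tfArg = λ () ; tfRes = λ () ; PF = ⊤ ; pfArg = λ _ → nameS 0 }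

-- The counterexample has no unknowns.
lemma4p17 : (lt : Atom → Bool) → Infinite lt → Coinfinite lt →
    Σ Signature λ S →
    Σ (List (Core.Form lt S)) λ Φ →
    Σ (List (Core.Form lt S)) λ Ψ →
    Σ (List Atom) λ D →
      Unique D
      × All (Core.WF lt S) Φ × All (Core.WF lt S) Ψ
      × Core.CapSet lt S D Φ × Core.CapSet lt S D Ψ
      × Core._⊢_ lt S Φ Ψ
      × ¬ Core._⊢H_ lt S (Core.trSet lt S D Φ) (Core.trSet lt S D Ψ)
lemma4p17 lt _ _ =
  Sig , pap tt (atm a) ∷ [] , pap tt (atm b) ∷ [] , [] , [] ,
  wf-pap (s-atm a) ∷ [] , wf-pap (s-atm b) ∷ [] ,
  cf-pap ct-atm ∷ [] , cf-pap ct-atm ∷ [] ,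
  ⊢-swap lt Sig refl , ⊬H-distinct-atoms [] (λ ())
  where
  open Core lt Sig
  open HOLErasure lt Sig
  a b : Atom
  a = atom 0 0
  b = atom 0 1
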